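{- Assume propositional truncations and function extensionality for $\mathbf{0}$-valued functions. Let $P,Q:\prod_{X:\mathcal{U}}X\to\mathcal{U}$ be invariant under equivalence, i.e. whenever there is an equivalence $X\to Y$ sending $x:X$ to $y:Y$, we have $P_X(x)\simeq P_Y(y)$ and $Q_X(x)\simeq Q_Y(y)$. Suppose that $P_Z(z)\vee Q_Z(z)$ for all $Z:\mathcal{U}$ and $z:Z$, and that there are types $X,Y:\mathcal{U}$ with points $x:X$, $y:Y$ such that $\neg P_X(x)$ and $\neg Q_Y(y)$. Suppose finally that either the type theory has pushouts, or the types $x=x$ and $y=y$ are propositions. Then weak excluded middle holds.
   Context: Work in intensional Martin-Löf type theory with $\Pi$-, $\Sigma$-, identity, finite types and natural numbers, and a universe $\mathcal{U}$ closed under these, extended with propositional truncations $\|A\|$ (universal proposition receiving a map from $A$). For propositions $A,B$, $A\vee B$ is $\|A+B\|$. $\neg A$ is $A\to\mathbf{0}$; $P_X$ abbreviates $P(X)$. A type is a proposition if any two elements are equal. Weak excluded middle: for all $A:\mathcal{U}$, $\neg A+\neg\neg A$. An equivalence is a map with a left and a right inverse; $A\simeq B$ means there is one. "Pushouts" means the type theory has (homotopy) pushouts of spans of types as higher inductive types. -}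

{-# OPTIONS --without-K #-}
module Defs where

open import Level using (Level; _⊔_) renaming (suc to lsuc; zero to lzero)
open import Data.Empty using (⊥)
open import Data.Sum using (_⊎_)
open import Data.Product using (Σ; _×_; _,_)
open import Relation.Nullary using (¬_)
open import Relation.Binary.PropositionalEquality using (_≡_; refl; sym; trans; cong; subst)

isProp : ∀ {ℓ} → Set ℓ → Set ℓ
isProp A = (a b : A) → a ≡ b

isEquiv : ∀ {ℓ ℓ'} {A : Set ℓ} {B : Set ℓ'} → (A → B) → Set (ℓ ⊔ ℓ')
isEquiv {A = A} {B} f =
  (Σ (B → A) λ g → (a : A) → g (f a) ≡ a) × (Σ (B → A) λ h → (b : B) → f (h b) ≡ b)

_≃_ : ∀ {ℓ ℓ'} → Set ℓ → Set ℓ' → Set (ℓ ⊔ ℓ')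
A ≃ B = Σ (A → B) isEquiv

record PropTrunc : Set₁ where
  field
    ∥_∥ : Set → Set
    ∣_∣ : {A : Set} → A → ∥ A ∥
    ∥∥-isProp : {A : Set} → isProp ∥ A ∥
    ∥∥-rec : {A B : Set} → isProp B → (A → B) → ∥ A ∥ → B

module _ (T : PropTrunc) where
  open PropTrunc T
  _∨_ : Set → Set → Set
  A ∨ B = ∥ A ⊎ B ∥

FunextEmpty : Set₁
FunextEmpty = (A : Set) (f g : A → ⊥) → ((a : A) → f a ≡ g a) → f ≡ g

WEM : Set₁
WEM = (A : Set) → ¬ A ⊎ ¬ ¬ A

apd : ∀ {ℓ ℓ'} {A : Set ℓ} {D : A → Set ℓ'} (h : (a : A) → D a) {a b : A}
      (p : a ≡ b) → subst D p (h a) ≡ h b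
apd h refl = refl

record Pushouts : Set₁ where
  field
    Pushout : {A B C : Set} (f : C → A) (g : C → B) → Set
    inl : {A B C : Set} {f : C → A} {g : C → B} → A → Pushout f g
    inr : {A B C : Set} {f : C → A} {g : C → B} → B → Pushout f g
    glue : {A B C : Set} {f : C → A} {g : C → B} (c : C) →
           inl {f = f} {g} (f c) ≡ inr (g c)
    ind : {A B C : Set} {f : C → A} {g : C → B} (D : Pushout f g → Set)
          (l : (a : A) → D (inl a)) (r : (b : B) → D (inr b))
          (p : (c : C) → subst D (glue c) (l (f c)) ≡ r (g c)) →
          (w : Pushout f g) → D w
    ind-inl : {A B C : Set} {f : C → A} {g : C → B} (D : Pushout f g → Set)
          (l : (a : A) → D (inl a)) (r : (b : B) → D (inr b))
          (p : (c : C) → subst D (glue c) (l (f c)) ≡ r (g c)) →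
          (a : A) → ind D l r p (inl a) ≡ l a
    ind-inr : {A B C : Set} {f : C → A} {g : C → B} (D : Pushout f g → Set)
          (l : (a : A) → D (inl a)) (r : (b : B) → D (inr b))
          (p : (c : C) → subst D (glue c) (l (f c)) ≡ r (g c)) →
          (b : B) → ind D l r p (inr b) ≡ r b
    ind-glue : {A B C : Set} {f : C → A} {g : C → B} (D : Pushout f g → Set)
          (l : (a : A) → D (inl a)) (r : (b : B) → D (inr b))
          (p : (c : C) → subst D (glue c) (l (f c)) ≡ r (g c)) →
          (c : C) →
          apd {D = D} (ind D l r p) (glue c)
            ≡ trans (cong (subst D (glue c)) (ind-inl D l r p (f c)))
                    (trans (p c) (sym (ind-inr D l r p (g c))))

EquivInvariant : ((X : Set) → X → Set) → Set₁
EquivInvariant P = (X Y : Set) (e : X → Y) → isEquiv e →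
                   (x : X) (y : Y) → e x ≡ y → P X x ≃ P Y y

{-# OPTIONS --without-K #-}
-- Fix A and build, from the pointed type (X, x), a pointed type (G, g) that is
-- pointedly equivalent to (X, x) when ¬ A holds and contractible when A holds;
-- similarly from (Y, y) one that is equivalent to (Y, y) when A holds and
-- contractible when ¬ A holds.  Such a "switch" exists in two ways:
--   * the subtype  Σ x' ∶ X, ∥ x ≡ x' + C ∥  of X, when x ≡ x is a proposition;
--   * the join of X with a proposition B (pushout of X ← X × B → B).
-- Let Z be the product of the two switches and z its base point.  Since
-- P Z z ∨ Q Z z and the goal ¬ A + ¬ ¬ A is a proposition (funext for ⊥),
-- we may case split: if P Z z, then under ¬ A we have (Z, z) ≃ (X, x) and
-- hence P X x, which is absurd, so ¬ ¬ A; if Q Z z, then under A we have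
-- (Z, z) ≃ (Y, y), so Q Y y, absurd, hence ¬ A.
module Submission where

open import Defs
open import Data.Empty using (⊥-elim)
open import Data.Sum using (_⊎_; inj₁; inj₂)
open import Data.Product using (Σ; _×_; _,_; proj₁; proj₂)
open import Relation.Nullary using (¬_)
open import Relation.Binary.PropositionalEquality
  using (_≡_; refl; sym; trans; cong; subst)
open import Relation.Binary.PropositionalEquality.Properties using (trans-symˡ)

isProp-¬ : FunextEmpty → (C : Set) → isProp (¬ C)
isProp-¬ fe C f g = fe C f g (λ c → ⊥-elim (f c))

-- ¬ A + ¬ ¬ A is a proposition: its summands are propositions and exclusive.
isProp-wem : FunextEmpty → (A : Set) → isProp (¬ A ⊎ ¬ ¬ A)
isProp-wem fe A (inj₁ f) (inj₁ g) = cong inj₁ (isProp-¬ fe A f g)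
isProp-wem fe A (inj₁ f) (inj₂ k) = ⊥-elim (k f)
isProp-wem fe A (inj₂ k) (inj₁ f) = ⊥-elim (k f)
isProp-wem fe A (inj₂ k) (inj₂ h) = cong inj₂ (isProp-¬ fe (¬ A) k h)

isContr : Set → Set
isContr G = Σ G λ c → (w : G) → c ≡ w

PointedEquiv : (G : Set) → G → (X : Set) → X → Set
PointedEquiv G g X x = Σ (G → X) λ e → isEquiv e × (e g ≡ x)

isEquiv-∘ : {A B C : Set} (f : A → B) (g : B → C) →
            isEquiv f → isEquiv g → isEquiv (λ a → g (f a))
isEquiv-∘ f g ((lf , lf-f) , (rf , f-rf)) ((lg , lg-g) , (rg , g-rg)) =
  ((λ c → lf (lg c)) , λ a → trans (cong lf (lg-g (f a))) (lf-f a)) ,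
  ((λ c → rf (rg c)) , λ c → trans (cong g (f-rf (rg c))) (g-rg c))

isEquiv-proj₁ : {A B : Set} → isContr B → isEquiv {A = A × B} proj₁
isEquiv-proj₁ (c , contr) =
  ((λ a → a , c) , λ { (a , b) → cong (a ,_) (contr b) }) ,
  ((λ a → a , c) , λ a → refl)

isEquiv-proj₂ : {A B : Set} → isContr A → isEquiv {A = A × B} proj₂
isEquiv-proj₂ (c , contr) =
  ((λ b → c , b) , λ { (a , b) → cong (_, b) (contr a) }) ,
  ((λ b → c , b) , λ b → refl)

drop-contrʳ : {G H X : Set} {g : G} {h : H} {x : X} →
              PointedEquiv G g X x → isContr H → PointedEquiv (G × H) (g , h) X x
drop-contrʳ (e , e-equiv , eg≡x) H-contr =
  (λ p → e (proj₁ p)) , isEquiv-∘ proj₁ e (isEquiv-proj₁ H-contr) e-equiv , eg≡x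

drop-contrˡ : {G H X : Set} {g : G} {h : H} {x : X} →
              isContr G → PointedEquiv H h X x → PointedEquiv (G × H) (g , h) X x
drop-contrˡ G-contr (e , e-equiv , eh≡x) =
  (λ p → e (proj₂ p)) , isEquiv-∘ proj₂ e (isEquiv-proj₂ G-contr) e-equiv , eh≡x

transport∙ : {P : (X : Set) → X → Set} → EquivInvariant P →
             {G X : Set} {g : G} {x : X} → PointedEquiv G g X x → P G g → P X x
transport∙ inv {G} {X} {g} {x} (e , e-equiv , eg≡x) = proj₁ (inv G X e e-equiv g x eg≡x)

record Switch (X : Set) (x : X) (C D : Set) : Set₁ where
  field
    Carrier : Set
    point : Carrier
    equiv-on : C → PointedEquiv Carrier point X x
    contr-on : D → isContr Carrier

switch-map : {X : Set} {x : X} {C D C' D' : Set} →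
             (C' → C) → (D' → D) → Switch X x C D → Switch X x C' D'
switch-map f h S = record
  { Carrier = Carrier ; point = point
  ; equiv-on = λ c → equiv-on (f c) ; contr-on = λ d → contr-on (h d) }
  where open Switch S

wem-from-switches : (T : PropTrunc) → FunextEmpty →
  (P Q : (X : Set) → X → Set) → EquivInvariant P → EquivInvariant Q →
  ((Z : Set) (z : Z) → _∨_ T (P Z z) (Q Z z)) →
  {X Y : Set} {x : X} {y : Y} → ¬ P X x → ¬ Q Y y →
  (A : Set) → Switch X x (¬ A) A → Switch Y y A (¬ A) → ¬ A ⊎ ¬ ¬ A
wem-from-switches T fe P Q invP invQ P∨Q {x = x} {y} ¬Px ¬Qy A SX SY =
  ∥∥-rec (isProp-wem fe A) decide (P∨Q Z z)
  where
    open PropTrunc T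
    module SX = Switch SX
    module SY = Switch SY
    Z : Set
    Z = SX.Carrier × SY.Carrier
    z : Z
    z = SX.point , SY.point
    product≃X : ¬ A → PointedEquiv Z z _ x
    product≃X n = drop-contrʳ (SX.equiv-on n) (SY.contr-on n)
    product≃Y : A → PointedEquiv Z z _ y
    product≃Y a = drop-contrˡ (SX.contr-on a) (SY.equiv-on a)
    decide : P Z z ⊎ Q Z z → ¬ A ⊎ ¬ ¬ A
    decide (inj₁ Pz) = inj₂ λ n → ¬Px (transport∙ invP (product≃X n) Pz)
    decide (inj₂ Qz) = inj₁ λ a → ¬Qy (transport∙ invQ (product≃Y a) Qz)

isProp-paths : {X : Set} {x : X} → isProp (x ≡ x) → (x' : X) → isProp (x ≡ x')
isProp-paths loops _ refl q = loops refl q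

subtype-switch : (T : PropTrunc) {X : Set} (x : X) → isProp (x ≡ x) →
                 (C : Set) → Switch X x C (¬ C)
subtype-switch T {X} x loops C = record
  { Carrier = G ; point = g ; equiv-on = equiv-on ; contr-on = contr-on }
  where
    open PropTrunc T
    G : Set
    G = Σ X λ x' → ∥ (x ≡ x') ⊎ C ∥
    g : G
    g = x , ∣ inj₁ refl ∣
    equiv-on : C → PointedEquiv G g X x
    equiv-on c = proj₁ , ((incl , λ { (x' , t) → cong (x' ,_) (∥∥-isProp _ _) }) ,
                          (incl , λ x' → refl)) , refl
      where
        incl : X → G
        incl x' = x' , ∣ inj₂ c ∣
    -- Without C, every element of G lies over a point equal to x.
    contr-on : ¬ C → isContr G
    contr-on ¬c = g , λ { (x' , t) → from-path x' (∥∥-rec (isProp-paths loops x') path t) t }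
      where
        path : {x' : X} → (x ≡ x') ⊎ C → x ≡ x'
        path (inj₁ p) = p
        path (inj₂ c) = ⊥-elim (¬c c)
        from-path : (x' : X) → x ≡ x' → (t : ∥ (x ≡ x') ⊎ C ∥) → g ≡ (x' , t)
        from-path _ refl t = cong (x ,_) (∥∥-isProp _ _)

subst-path : {A : Set} {a b c : A} (q : b ≡ c) (p : a ≡ b) → subst (a ≡_) q p ≡ trans p q
subst-path refl refl = refl

join-switch : Pushouts → {X : Set} (x : X) (B : Set) → isProp B → Switch X x (¬ B) B
join-switch PO {X} x B B-prop = record
  { Carrier = W ; point = inl x ; equiv-on = equiv-on ; contr-on = contr-on }
  where
    open Pushouts PO
    W : Set
    W = Pushout {X} {B} {X × B} proj₁ proj₂
    -- Without B the right leg and the glue are vacuous, so W is X.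
    equiv-on : ¬ B → PointedEquiv W (inl x) X x
    equiv-on ¬b = collapse , ((inl , inl-collapse) , (inl , collapse-inl)) , collapse-inl x
      where
        collapse : W → X
        collapse = ind (λ _ → X) (λ x' → x') (λ b → ⊥-elim (¬b b)) (λ c → ⊥-elim (¬b (proj₂ c)))
        collapse-inl : (x' : X) → collapse (inl x') ≡ x'
        collapse-inl = ind-inl (λ _ → X) (λ x' → x') (λ b → ⊥-elim (¬b b))
                               (λ c → ⊥-elim (¬b (proj₂ c)))
        inl-collapse : (w : W) → inl (collapse w) ≡ w
        inl-collapse = ind (λ w → inl (collapse w) ≡ w) (λ x' → cong inl (collapse-inl x'))
                           (λ b → ⊥-elim (¬b b)) (λ c → ⊥-elim (¬b (proj₂ c)))
    -- Given b₀ : B, every point is connected to inr b₀: points inl x' via the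
    -- glue at (x', b₀), points inr b since B is a proposition.
    contr-on : B → isContr W
    contr-on b₀ = inr b₀ , ind (λ w → inr b₀ ≡ w) (λ x' → sym (glue (x' , b₀)))
                               (λ b → cong inr (B-prop b₀ b)) coherence
      where
        glue-square : (x' : X) (b : B) (q : b₀ ≡ b) →
                      trans (sym (glue {f = proj₁} {g = proj₂} (x' , b₀))) (glue (x' , b))
                        ≡ cong inr q
        glue-square x' _ refl = trans-symˡ (glue (x' , b₀))
        coherence : (c : X × B) →
                    subst (inr b₀ ≡_) (glue c) (sym (glue (proj₁ c , b₀)))
                      ≡ cong inr (B-prop b₀ (proj₂ c))
        coherence (x' , b) = trans (subst-path (glue (x' , b)) (sym (glue (x' , b₀))))
                                   (glue-square x' b (B-prop b₀ b))

theorem2p12 : (T : PropTrunc) → FunextEmpty →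
    (P Q : (X : Set) → X → Set) →
    EquivInvariant P → EquivInvariant Q →
    ((Z : Set) (z : Z) → _∨_ T (P Z z) (Q Z z)) →
    (X Y : Set) (x : X) (y : Y) → ¬ P X x → ¬ Q Y y →
    Pushouts ⊎ (isProp (x ≡ x) × isProp (y ≡ y)) →
    WEM
theorem2p12 T fe P Q invP invQ P∨Q X Y x y ¬Px ¬Qy construction A =
  wem-from-switches T fe P Q invP invQ P∨Q ¬Px ¬Qy A (switchX construction) (switchY construction)
  where
    ¬¬-intro : {C : Set} → C → ¬ ¬ C
    ¬¬-intro c k = k c
    switchX : Pushouts ⊎ (isProp (x ≡ x) × isProp (y ≡ y)) → Switch X x (¬ A) A
    switchX (inj₁ PO) = switch-map ¬¬-intro ¬¬-intro (join-switch PO x (¬ ¬ A) (isProp-¬ fe (¬ A)))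
    switchX (inj₂ (loopsX , _)) = switch-map (λ n → n) ¬¬-intro (subtype-switch T x loopsX (¬ A))
    switchY : Pushouts ⊎ (isProp (x ≡ x) × isProp (y ≡ y)) → Switch Y y A (¬ A)
    switchY (inj₁ PO) = switch-map ¬¬-intro (λ n → n) (join-switch PO y (¬ A) (isProp-¬ fe A))
    switchY (inj₂ (_ , loopsY)) = switch-map ¬¬-intro ¬¬-intro (subtype-switch T y loopsY (¬ ¬ A))
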